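{- Let $A$ be a set, let $\mathscr C\subseteq\mathscr D$ be function clones on $A$, and let $\mathscr G$ be a permutation group on $A$ such that $\mathscr D$ locally interpolates $\mathscr C$ modulo $\mathscr G$. Let $(S,\sim)$ be a subfactor of $\mathscr C$ with $\mathscr G$-invariant $\sim$-classes. (a) If $\sim$ has a $\mathscr D$-invariant very smooth approximation $\eta$ with respect to $\mathscr G$, then there exists a clone homomorphism from $\mathscr D$ to the clone $\mathscr C\curvearrowright S/{\sim}$. (b) If $\sim$ has a $\mathscr D$-invariant smooth approximation $\eta$ with respect to $\mathscr G$, then there exists a minion homomorphism from $\mathscr D$ to $\mathscr C\curvearrowright S/{\sim}$. Moreover, if $\sim$ has finitely many classes, then the homomorphism in (a), resp. (b), can be taken uniformly continuous.
   Context: A function clone on $A$ is a set of finitary operations on $A$ containing all projections and closed under composition. A subfactor of $\mathscr C$ is a pair $(S,\sim)$ where $S\subseteq A$ is invariant under $\mathscr C$ and $\sim$ is a $\mathscr C$-invariant equivalence relation on $S$; $\mathscr C\curvearrowright S/{\sim}$ is the clone on the set of $\sim$-classes induced by the action of $\mathscr C$ on representatives. A function $f$ locally interpolates $g$ (both $k$-ary) modulo $\mathscr G$ if $g$ lies in the closure, in the topology of pointwise convergence, of $\{\beta\circ f(\alpha_1(x_1),\dots,\alpha_k(x_k))\mid\beta,\alpha_1,\dots,\alpha_k\in\mathscr G\}$; $\mathscr D$ locally interpolates $\mathscr C$ modulo $\mathscr G$ if every function of $\mathscr D$ locally interpolates some function of $\mathscr C$. An approximation of $\sim$ is an equivalence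 relation $\eta$ on some $S'$ with $S\subseteq S'\subseteq A$ whose restriction to $S$ refines $\sim$. For $\mathscr G$ leaving $\eta$ and the $\sim$-classes invariant, $\eta$ is very smooth if $\mathscr G$-orbit equivalence on $S$ refines $\eta$; smooth if each $\sim$-class $C$ meets some $\eta$-class $C'$ such that $C\cap C'$ contains a whole $\mathscr G$-orbit. A clone homomorphism preserves arities, projections and composition; a minion homomorphism preserves arities and composition with projections. A (clone or minion) homomorphism $\xi$ from $\mathscr D$ to a clone on a finite set is uniformly continuous if for every $n$ there is a finite $F\subseteq A^n$ such that $\xi(f)=\xi(g)$ whenever $n$-ary $f,g\in\mathscr D$ agree on $F$. -}

module Defs where

open import Data.Nat using (ℕ)
open import Data.Fin using (Fin)
open import Data.List using (List)
open import Data.List.Membership.Propositional using (_∈_)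
open import Data.Product using (Σ; _×_; ∃)
open import Relation.Binary.PropositionalEquality using (_≡_)

Op : Set → ℕ → Set
Op A n = (Fin n → A) → A

proj : {A : Set} (n : ℕ) → Fin n → Op A n
proj n i x = x i

compose : {A : Set} {m n : ℕ} → Op A m → (Fin m → Op A n) → Op A n
compose f g x = f (λ i → g i x)

minor : {A : Set} {m n : ℕ} → Op A m → (Fin m → Fin n) → Op A n
minor f σ x = f (λ i → x (σ i))

OpSet : Set → Set₁
OpSet A = (n : ℕ) → Op A n → Set

record IsClone {A : Set} (C : OpSet A) : Set where
  field
    proj∈    : (n : ℕ) (i : Fin n) → C n (proj n i)
    compose∈ : {m n : ℕ} (f : Op A m) (g : Fin m → Op A n) →
               C m f → ((i : Fin m) → C n (g i)) → C n (compose f g)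

_⊆ᶜ_ : {A : Set} → OpSet A → OpSet A → Set
C ⊆ᶜ D = ∀ n f → C n f → D n f

record IsPermGroup {A : Set} (G : (A → A) → Set) : Set where
  field
    id∈   : G (λ a → a)
    comp∈ : ∀ α β → G α → G β → G (λ a → α (β a))
    inv∈  : ∀ α → G α → Σ (A → A) λ β → G β ×
              ((∀ a → β (α a) ≡ a) × (∀ a → α (β a) ≡ a))

-- f locally interpolates g modulo G: g is in the pointwise-convergence
-- closure of {β ∘ f(α₁ x₁,…,αₖ xₖ)}, i.e. on every finite set of
-- arguments some member of that set agrees with g.
LocInterp : {A : Set} (G : (A → A) → Set) {k : ℕ} → Op A k → Op A k → Set
LocInterp {A} G {k} f g =
  (F : List (Fin k → A)) →
  Σ (A → A) λ β → Σ (Fin k → A → A) λ α →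
    G β × ((i : Fin k) → G (α i)) ×
    ((x : Fin k → A) → x ∈ F → β (f (λ i → α i (x i))) ≡ g x)

LocInterpClone : {A : Set} (G : (A → A) → Set) → OpSet A → OpSet A → Set
LocInterpClone {A} G D C =
  ∀ n f → D n f → Σ (Op A n) λ g → C n g × LocInterp G f g

InvSet : {A : Set} → OpSet A → (A → Set) → Set
InvSet {A} C S = ∀ n f → C n f → (x : Fin n → A) → (∀ i → S (x i)) → S (f x)

record IsEquivOn {A : Set} (S : A → Set) (R : A → A → Set) : Set where
  field
    dom   : ∀ {x y} → R x y → S x × S y
    refl′ : ∀ {x} → S x → R x x
    sym′  : ∀ {x y} → R x y → R y x
    trans′ : ∀ {x y z} → R x y → R y z → R x z

InvRel : {A : Set} → OpSet A → (A → A → Set) → Set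
InvRel {A} C R = ∀ n f → C n f → (x y : Fin n → A) →
  (∀ i → R (x i) (y i)) → R (f x) (f y)

record IsSubfactor {A : Set} (C : OpSet A) (S : A → Set) (_∼_ : A → A → Set) : Set where
  field
    S-inv  : InvSet C S
    ∼-equiv : IsEquivOn S _∼_
    ∼-inv  : InvRel C _∼_

ClassesInv : {A : Set} (G : (A → A) → Set) (S : A → Set) (_∼_ : A → A → Set) → Set
ClassesInv {A} G S _∼_ = ∀ α → G α → ∀ x → S x → α x ∼ x

record IsApprox {A : Set} (S : A → Set) (_∼_ : A → A → Set)
                (S′ : A → Set) (η : A → A → Set) : Set where
  field
    S⊆S′   : ∀ x → S x → S′ x
    η-equiv : IsEquivOn S′ η
    refines : ∀ x y → S x → S y → η x y → x ∼ y

record IsInvApprox {A : Set} (D : OpSet A) (S′ : A → Set) (η : A → A → Set) : Set where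
  field
    S′-inv : InvSet D S′
    η-inv  : InvRel D η

PreservesRel : {A : Set} (G : (A → A) → Set) (η : A → A → Set) → Set
PreservesRel {A} G η = ∀ α → G α → ∀ x y → η x y → η (α x) (α y)

VerySmooth : {A : Set} (G : (A → A) → Set) (S : A → Set) (η : A → A → Set) → Set
VerySmooth {A} G S η =
  PreservesRel G η ×
  (∀ x y → S x → S y → (Σ (A → A) λ α → G α × α x ≡ y) → η x y)

Smooth : {A : Set} (G : (A → A) → Set) (S : A → Set) (_∼_ : A → A → Set)
         (η : A → A → Set) → Set
Smooth {A} G S _∼_ η =
  PreservesRel G η ×
  (∀ c → S c → Σ A λ e → S e × e ∼ c ×
      (∀ α → G α → (α e ∼ c) × η e (α e)))

-- The clone C ↷ S/∼ : its operations are represented by elements of C,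
-- two representatives being equal iff they induce the same operation on
-- S/∼, i.e. agree up to ∼ on all tuples from S.
_≈[_,_]_ : {A : Set} {n : ℕ} → Op A n → (A → Set) → (A → A → Set) → Op A n → Set
_≈[_,_]_ {A} {n} f S _∼_ g = (x : Fin n → A) → (∀ i → S (x i)) → f x ∼ g x

MapInto : {A : Set} → OpSet A → OpSet A → Set
MapInto {A} D C = ∀ n f → D n f → Σ (Op A n) (C n)

module _ {A : Set} {C D : OpSet A} (Dcl : IsClone D)
         (S : A → Set) (_∼_ : A → A → Set) (ξ : MapInto D C) where
  open IsClone Dcl
  private
    ⟦_⟧ : ∀ {n f} → D n f → Op A n
    ⟦ p ⟧ = Data.Product.proj₁ (ξ _ _ p)

  WellDefined : Set
  WellDefined = ∀ n f g (p : D n f) (q : D n g) → (∀ x → f x ≡ g x) →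
                ⟦ p ⟧ ≈[ S , _∼_ ] ⟦ q ⟧

  record IsCloneHom : Set where
    field
      wd      : WellDefined
      pres-proj : ∀ n i → ⟦ proj∈ n i ⟧ ≈[ S , _∼_ ] proj n i
      pres-comp : ∀ {m n} (f : Op A m) (g : Fin m → Op A n)
                  (p : D m f) (q : (i : Fin m) → D n (g i)) →
                  ⟦ compose∈ f g p q ⟧ ≈[ S , _∼_ ] compose ⟦ p ⟧ (λ i → ⟦ q i ⟧)

  record IsMinionHom : Set where
    field
      wd      : WellDefined
      pres-minor : ∀ {m n} (f : Op A m) (σ : Fin m → Fin n)
                   (p : D m f) (q : D n (minor f σ)) →
                   ⟦ q ⟧ ≈[ S , _∼_ ] minor ⟦ p ⟧ σ

  UniformlyContinuous : Set
  UniformlyContinuous = (n : ℕ) → Σ (List (Fin n → A)) λ F →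
    ∀ f g (p : D n f) (q : D n g) → (∀ x → x ∈ F → f x ≡ g x) →
    ⟦ p ⟧ ≈[ S , _∼_ ] ⟦ q ⟧

FinitelyManyClasses : {A : Set} (S : A → Set) (_∼_ : A → A → Set) → Set
FinitelyManyClasses {A} S _∼_ =
  Σ (List A) λ L → (∀ a → a ∈ L → S a) × (∀ x → S x → Σ A λ a → a ∈ L × x ∼ a)

{-# OPTIONS --safe #-}
-- For f ∈ 𝒟 let ⟦f⟧ ∈ 𝒞 be a function it locally interpolates. Call e ∈ S
-- rigid if its whole 𝒢-orbit lies in its η-class. On a rigid tuple b the
-- interpolation at the single point b gives β ∘ f ∘ α = ⟦f⟧ at b, so
-- f(α b) lies in the ∼-class of ⟦f⟧(b); since η is 𝒟-invariant and
-- b η α b, also f(b) η f(α b). As η refines ∼ on S, the ∼-class of ⟦f⟧(b)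
-- is thus determined by f(b) alone, and f ↦ ⟦f⟧ is compatible with the
-- clone operations evaluated at rigid tuples. Smoothness provides a rigid
-- representative of every ∼-class, which yields a minion homomorphism;
-- very smoothness makes all of S rigid, so composition is preserved too.
-- With finitely many classes, agreement on the finitely many tuples of
-- chosen rigid representatives already determines the image.
module Submission where

open import Defs
open import Data.Product using (Σ; _×_; _,_; proj₁; proj₂)
open import Data.Nat using (ℕ; zero; suc)
open import Data.Fin using (Fin; zero; suc)
open import Data.List using (List; []; _∷_; cartesianProductWith)
open import Data.List.Membership.Propositional using (_∈_; mapWith∈)
open import Data.List.Membership.Propositional.Properties using (∈-cartesianProductWith⁺)
open import Data.List.Relation.Unary.Any using (here)
open import Data.List.Relation.Unary.Any.Properties using (mapWith∈⁺)
import Data.Vec.Functional as V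
open import Relation.Binary.PropositionalEquality using (_≡_; refl; sym; trans; cong; subst)

module _ {A : Set} where

  tuples : List A → (n : ℕ) → List (Fin n → A)
  tuples L zero    = V.[] ∷ []
  tuples L (suc n) = cartesianProductWith V._∷_ L (tuples L n)

  tuples-cover : (L : List A) (R : A → A → Set) (n : ℕ) (x : Fin n → A) →
                 (∀ i → Σ A λ r → r ∈ L × R (x i) r) →
                 Σ (Fin n → A) λ b → b ∈ tuples L n × (∀ i → R (x i) (b i))
  tuples-cover L R zero    x cover = V.[] , here refl , λ ()
  tuples-cover L R (suc n) x cover
    with cover zero | tuples-cover L R n (λ i → x (suc i)) (λ i → cover (suc i))
  ... | r , r∈L , xr | b , b∈ , xb =
    r V.∷ b , ∈-cartesianProductWith⁺ V._∷_ r∈L b∈ , λ { zero → xr ; (suc i) → xb i }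

module Interpolant {A : Set} (C D : OpSet A) (Dcl : IsClone D)
    (G : (A → A) → Set) (Ggr : IsPermGroup G)
    (interp : LocInterpClone G D C)
    (S : A → Set) (_∼_ : A → A → Set) (sf : IsSubfactor C S _∼_)
    (Ginv : ClassesInv G S _∼_)
    (S′ : A → Set) (η : A → A → Set) (ap : IsApprox S _∼_ S′ η)
    (ia : IsInvApprox D S′ η) where

  open IsSubfactor sf
  open IsEquivOn ∼-equiv
  open IsApprox ap
  module η = IsEquivOn η-equiv
  open IsInvApprox ia
  open IsPermGroup Ggr
  open IsClone Dcl

  Rigid : A → Set
  Rigid e = S e × (∀ α → G α → η e (α e))

  RigidRepresentatives : Set
  RigidRepresentatives = ∀ c → S c → Σ A λ e → Rigid e × e ∼ c

  verySmooth⇒S⊆Rigid : VerySmooth G S η → ∀ x → S x → Rigid x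
  verySmooth⇒S⊆Rigid (_ , orbit⊆η) x Sx =
    Sx , λ α Gα → orbit⊆η x (α x) Sx (proj₁ (dom (Ginv α Gα x Sx))) (α , Gα , refl)

  S⊆Rigid⇒representatives : (∀ x → S x → Rigid x) → RigidRepresentatives
  S⊆Rigid⇒representatives S⊆Rigid c Sc = c , S⊆Rigid c Sc , refl′ Sc

  smooth⇒representatives : Smooth G S _∼_ η → RigidRepresentatives
  smooth⇒representatives (_ , smooth) c Sc with smooth c Sc
  ... | e , Se , e∼c , orbit = e , (Se , λ α Gα → proj₂ (orbit α Gα)) , e∼c

  Meets : A → A → Set
  Meets t c = Σ A λ s → S s × η t s × c ∼ s

  meets-unique : ∀ {t c c′} → Meets t c → Meets t c′ → c ∼ c′
  meets-unique (s , Ss , ts , cs) (s′ , Ss′ , ts′ , c′s′) =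
    trans′ cs (trans′ (refines s s′ Ss Ss′ (η.trans′ (η.sym′ ts) ts′)) (sym′ c′s′))

  η-meets : ∀ {t t′ c} → η t t′ → Meets t′ c → Meets t c
  η-meets tt′ (s , Ss , t′s , cs) = s , Ss , η.trans′ tt′ t′s , cs

  ∼-meets : ∀ {t c c′} → c′ ∼ c → Meets t c → Meets t c′
  ∼-meets c′c (s , Ss , ts , cs) = s , Ss , ts , trans′ c′c cs

  interpolant : MapInto D C
  interpolant n f p = proj₁ (interp n f p) , proj₁ (proj₂ (interp n f p))

  ⟦_⟧ : ∀ {n f} → D n f → Op A n
  ⟦ p ⟧ = proj₁ (interpolant _ _ p)

  ⟦⟧-cong : ∀ {n f} (p : D n f) {x y : Fin n → A} → (∀ i → x i ∼ y i) → ⟦ p ⟧ x ∼ ⟦ p ⟧ y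
  ⟦⟧-cong p = ∼-inv _ _ (proj₂ (interpolant _ _ p)) _ _

  ⟦⟧-meets : ∀ {n f} (p : D n f) (b : Fin n → A) → (∀ i → Rigid (b i)) → Meets (f b) (⟦ p ⟧ b)
  ⟦⟧-meets {n} {f} p b rigid with proj₂ (proj₂ (interp n f p)) (b ∷ [])
  ... | β , α , Gβ , Gα , agree with inv∈ β Gβ
  ... | β⁻¹ , Gβ⁻¹ , β⁻¹β , _ =
    f αb , proj₁ (dom αb∼) ,
    η-inv _ f p b αb (λ i → proj₂ (rigid i) (α i) (Gα i)) , sym′ αb∼
    where
    αb : Fin n → A
    αb i = α i (b i)
    β⁻¹⟦p⟧b≡fαb : β⁻¹ (⟦ p ⟧ b) ≡ f αb
    β⁻¹⟦p⟧b≡fαb = trans (cong β⁻¹ (sym (agree b (here refl)))) (β⁻¹β _)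
    S⟦p⟧b : S (⟦ p ⟧ b)
    S⟦p⟧b = S-inv _ _ (proj₂ (interpolant _ _ p)) b (λ i → proj₁ (rigid i))
    αb∼ : f αb ∼ ⟦ p ⟧ b
    αb∼ = subst (_∼ ⟦ p ⟧ b) β⁻¹⟦p⟧b≡fαb (Ginv β⁻¹ Gβ⁻¹ _ S⟦p⟧b)

  ⟦⟧-agree-near-rigid : ∀ {n f g} (p : D n f) (q : D n g) {x b : Fin n → A} →
                        (∀ i → Rigid (b i)) → (∀ i → x i ∼ b i) → f b ≡ g b →
                        ⟦ p ⟧ x ∼ ⟦ q ⟧ x
  ⟦⟧-agree-near-rigid p q {b = b} rigid xb fb≡gb =
    trans′ (⟦⟧-cong p xb)
      (trans′ (meets-unique (⟦⟧-meets p b rigid)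
                            (subst (λ t → Meets t (⟦ q ⟧ b)) (sym fb≡gb) (⟦⟧-meets q b rigid)))
              (⟦⟧-cong q (λ i → sym′ (xb i))))

  module _ (reps : RigidRepresentatives) where

    representative : ∀ {n} (x : Fin n → A) → (∀ i → S (x i)) → Fin n → A
    representative x Sx i = proj₁ (reps (x i) (Sx i))

    representative-rigid : ∀ {n} (x : Fin n → A) (Sx : ∀ i → S (x i)) →
                           ∀ i → Rigid (representative x Sx i)
    representative-rigid x Sx i = proj₁ (proj₂ (reps (x i) (Sx i)))

    ∼-representative : ∀ {n} (x : Fin n → A) (Sx : ∀ i → S (x i)) →
                       ∀ i → x i ∼ representative x Sx i
    ∼-representative x Sx i = sym′ (proj₂ (proj₂ (reps (x i) (Sx i))))

    interpolant-wellDefined : WellDefined Dcl S _∼_ interpolant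
    interpolant-wellDefined n f g p q f≗g x Sx =
      ⟦⟧-agree-near-rigid p q (representative-rigid x Sx) (∼-representative x Sx) (f≗g _)

    interpolant-minionHom : IsMinionHom Dcl S _∼_ interpolant
    interpolant-minionHom = record { wd = interpolant-wellDefined ; pres-minor = pres-minor }
      where
      pres-minor : ∀ {m n} (f : Op A m) (σ : Fin m → Fin n) (p : D m f) (q : D n (minor f σ)) →
                   ⟦ q ⟧ ≈[ S , _∼_ ] minor ⟦ p ⟧ σ
      pres-minor f σ p q x Sx =
        trans′ (⟦⟧-cong q (∼-representative x Sx))
          (trans′ (meets-unique (⟦⟧-meets q b (representative-rigid x Sx))
                                (⟦⟧-meets p (λ i → b (σ i)) (λ i → representative-rigid x Sx (σ i))))
                  (⟦⟧-cong p (λ i → sym′ (∼-representative x Sx (σ i)))))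
        where
        b = representative x Sx

    interpolant-uniformlyContinuous : FinitelyManyClasses S _∼_ →
                                      UniformlyContinuous Dcl S _∼_ interpolant
    interpolant-uniformlyContinuous (L , L⊆S , L-covers) n =
      tuples rigidL n , λ f g p q agree x Sx →
        let b , b∈ , x∼b = tuples-cover rigidL NearRigid n x (near-rigidL x Sx)
        in ⟦⟧-agree-near-rigid p q (λ i → proj₁ (x∼b i)) (λ i → proj₂ (x∼b i)) (agree b b∈)
      where
      rigidRep : ∀ {a} → a ∈ L → A
      rigidRep {a} a∈L = proj₁ (reps a (L⊆S a a∈L))
      rigidL : List A
      rigidL = mapWith∈ L rigidRep
      NearRigid : A → A → Set
      NearRigid y r = Rigid r × y ∼ r
      near-rigidL : (x : Fin n → A) → (∀ i → S (x i)) →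
                    ∀ i → Σ A λ r → r ∈ rigidL × NearRigid (x i) r
      near-rigidL x Sx i =
        let a , a∈L , xa = L-covers (x i) (Sx i)
            _ , rigid , ra = reps a (L⊆S a a∈L)
        in rigidRep a∈L , mapWith∈⁺ rigidRep (a , a∈L , refl) , rigid , trans′ xa (sym′ ra)

  module _ (S⊆Rigid : ∀ x → S x → Rigid x) where

    interpolant-cloneHom : IsCloneHom Dcl S _∼_ interpolant
    interpolant-cloneHom = record
      { wd        = interpolant-wellDefined (S⊆Rigid⇒representatives S⊆Rigid)
      ; pres-proj = pres-proj
      ; pres-comp = pres-comp
      }
      where
      rigid : ∀ {n} {x : Fin n → A} → (∀ i → S (x i)) → ∀ i → Rigid (x i)
      rigid Sx i = S⊆Rigid _ (Sx i)

      pres-proj : ∀ n i → ⟦ proj∈ n i ⟧ ≈[ S , _∼_ ] proj n i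
      pres-proj n i x Sx =
        meets-unique (⟦⟧-meets (proj∈ n i) x (rigid Sx))
                     (x i , Sx i , η.refl′ (S⊆S′ _ (Sx i)) , refl′ (Sx i))

      -- η is f-invariant, so f (g x) may be replaced by f s, and s is rigid
      -- because it lies in S
      pres-comp : ∀ {m n} (f : Op A m) (g : Fin m → Op A n)
                  (p : D m f) (q : (i : Fin m) → D n (g i)) →
                  ⟦ compose∈ f g p q ⟧ ≈[ S , _∼_ ] compose ⟦ p ⟧ (λ i → ⟦ q i ⟧)
      pres-comp f g p q x Sx =
        meets-unique (⟦⟧-meets (compose∈ f g p q) x (rigid Sx))
          (∼-meets (⟦⟧-cong p (λ i → proj₂ (proj₂ (proj₂ (s i)))))
            (η-meets (η-inv _ f p _ _ (λ i → proj₁ (proj₂ (proj₂ (s i)))))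
              (⟦⟧-meets p (λ i → proj₁ (s i)) (λ i → S⊆Rigid _ (proj₁ (proj₂ (s i)))))))
        where
        s : ∀ i → Meets (g i x) (⟦ q i ⟧ x)
        s i = ⟦⟧-meets (q i) x (rigid Sx)

theorem3p9 : {A : Set} (C D : OpSet A) (Ccl : IsClone C) (Dcl : IsClone D)
    (C⊆D : C ⊆ᶜ D) (G : (A → A) → Set) (Ggr : IsPermGroup G)
    (interp : LocInterpClone G D C)
    (S : A → Set) (_∼_ : A → A → Set) (sf : IsSubfactor C S _∼_)
    (Ginv : ClassesInv G S _∼_) →
    -- (a)
    (∀ (S′ : A → Set) (η : A → A → Set) → IsApprox S _∼_ S′ η →
       IsInvApprox D S′ η → VerySmooth G S η →
       Σ (MapInto D C) (λ ξ → IsCloneHom Dcl S _∼_ ξ) ×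
       (FinitelyManyClasses S _∼_ →
         Σ (MapInto D C) (λ ξ → IsCloneHom Dcl S _∼_ ξ ×
                                 UniformlyContinuous Dcl S _∼_ ξ))) ×
    -- (b)
    (∀ (S′ : A → Set) (η : A → A → Set) → IsApprox S _∼_ S′ η →
       IsInvApprox D S′ η → Smooth G S _∼_ η →
       Σ (MapInto D C) (λ ξ → IsMinionHom Dcl S _∼_ ξ) ×
       (FinitelyManyClasses S _∼_ →
         Σ (MapInto D C) (λ ξ → IsMinionHom Dcl S _∼_ ξ ×
                                 UniformlyContinuous Dcl S _∼_ ξ)))
theorem3p9 C D Ccl Dcl C⊆D G Ggr interp S _∼_ sf Ginv =
  (λ S′ η ap ia verySmooth →
    let open Interpolant C D Dcl G Ggr interp S _∼_ sf Ginv S′ η ap ia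
        S⊆Rigid = verySmooth⇒S⊆Rigid verySmooth
        reps    = S⊆Rigid⇒representatives S⊆Rigid
    in (interpolant , interpolant-cloneHom S⊆Rigid) ,
       λ finite → interpolant , interpolant-cloneHom S⊆Rigid ,
                  interpolant-uniformlyContinuous reps finite) ,
  (λ S′ η ap ia smooth →
    let open Interpolant C D Dcl G Ggr interp S _∼_ sf Ginv S′ η ap ia
        reps = smooth⇒representatives smooth
    in (interpolant , interpolant-minionHom reps) ,
       λ finite → interpolant , interpolant-minionHom reps ,
                  interpolant-uniformlyContinuous reps finite)
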